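{- For $\mathbf{u}\in Q$, $$\mathcal{B}(\mathbf{u},r(\mathbf{u}))\subseteq\Delta(\mathbf{u})\subseteq\bar{\mathcal{B}}(\mathbf{u},r(\mathbf{u})).$$
   Context: $q$ a prime power, $\mathcal{R}=\mathbb{F}_q[x]$, $\mathcal{K}=\mathbb{F}_q(x)$ with $|f/g|=q^{\deg f-\deg g}$, $\widetilde{\mathcal{K}}=\mathbb{F}_q((x^{ -1}))$ its completion, $\widetilde{\mathcal{K}}^d$ with sup norm $\|\cdot\|$. $Q=\{(a_1,\dots,a_d,b)\in\mathcal{R}^{d+1}:\gcd(a_1,\dots,a_d,b)=1,\ b\neq0\}$; for $\mathbf{u}=(\mathbf{a},b)\in Q$, $\hat{\mathbf{u}}=\mathbf{a}/b$, $|\mathbf{u}|=|b|$, and $A(\boldsymbol{\theta},\mathbf{u})=\|b\boldsymbol{\theta}-\mathbf{a}\|$ for $\boldsymbol{\theta}\in\widetilde{\mathcal{K}}^d$. $\mathbf{u}\in Q$ is a best approximation of $\boldsymbol{\theta}$ if $A(\boldsymbol{\theta},\mathbf{u})<A(\boldsymbol{\theta},\mathbf{v})$ for every $\mathbf{v}\in Q$ with $|\mathbf{v}|<|\mathbf{u}|$ and $A(\boldsymbol{\theta},\mathbf{u})\le A(\boldsymbol{\theta},\mathbf{v})$ for every $\mathbf{v}\in Q$ with $|\mathbf{v}|\le|\mathbf{u}|$. $\Delta(\mathbf{u})$ is the set of $\boldsymbol{\theta}\in\widetilde{\mathcal{K}}^d$ for which $\mathbf{u}$ is a best approximation. $\mathcal{B}(\mathbf{u},r)=\{\boldsymbol{\theta}:A(\boldsymbol{\theta},\mathbf{u})<r\}$,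 $\bar{\mathcal{B}}(\mathbf{u},r)=\{\boldsymbol{\theta}:A(\boldsymbol{\theta},\mathbf{u})\le r\}$, and $r(\mathbf{u})=\min\{A(\hat{\mathbf{u}},\mathbf{v}):\mathbf{v}\in Q,\ |\mathbf{v}|\le|\mathbf{u}|,\ \mathbf{v}\notin\mathbb{F}_q^*\mathbf{u}\}$. -}

module Defs where

open import Level using (0ℓ)
open import Algebra.Bundles using (CommutativeRing)
open import Data.Nat as ℕ using (ℕ; zero; suc)
open import Data.Integer as ℤ using (ℤ; +_; -[1+_])
open import Data.Fin using (Fin)
open import Data.List using (List)
open import Data.List.Relation.Unary.Any using (Any)
open import Data.Product using (Σ; ∃; _×_; _,_)
open import Relation.Nullary using (¬_; Dec)

record FiniteField : Set₁ where
  field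
    cring    : CommutativeRing 0ℓ 0ℓ
  open CommutativeRing cring public
  field
    1≉0      : ¬ (1# ≈ 0#)
    inverse  : ∀ x → ¬ (x ≈ 0#) → ∃ λ y → x * y ≈ 1#
    _≟F_     : ∀ x y → Dec (x ≈ y)
    elements : List Carrier
    complete : ∀ x → Any (λ y → x ≈ y) elements

module _ (F : FiniteField) where
  open FiniteField F

  sumF : ℕ → (ℕ → Carrier) → Carrier
  sumF zero    f = 0#
  sumF (suc n) f = sumF n f + f n

  record Poly : Set where
    field
      coeff  : ℕ → Carrier
      len    : ℕ
      vanish : ∀ k → len ℕ.≤ k → coeff k ≈ 0#
  open Poly public

  -- Elements of F_q((x⁻¹)): Laurent series  Σ_{k ≤ N} c_k x^k.
  record Series : Set where
    field
      scoeff  : ℤ → Carrier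
      top     : ℤ
      svanish : ∀ k → top ℤ.< k → scoeff k ≈ 0#
  open Series public

  polyZ : Poly → ℤ → Carrier
  polyZ p (+ n)    = coeff p n
  polyZ p -[1+ n ] = 0#

  polySeries : Poly → Series → ℤ → Carrier
  polySeries b θ k = sumF (len b) (λ i → coeff b i * scoeff θ (k ℤ.- + i))

  polyMulCoeff : Poly → Poly → ℕ → Carrier
  polyMulCoeff c e k = sumF (suc k) (λ i → coeff c i * coeff e (k ℕ.∸ i))

  _≈P_ : Poly → Poly → Set
  p ≈P p' = ∀ k → coeff p k ≈ coeff p' k

  _∣P_ : Poly → Poly → Set
  c ∣P p = ∃ λ (e : Poly) → ∀ k → polyMulCoeff c e k ≈ coeff p k

  oneCoeff : ℕ → Carrier
  oneCoeff zero    = 1#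
  oneCoeff (suc k) = 0#

  UnitP : Poly → Set
  UnitP c = ∃ λ (e : Poly) → ∀ k → polyMulCoeff c e k ≈ oneCoeff k

  -- Absolute values.  All nonzero values of |·| and ‖·‖ are integer
  -- powers of q, so  |f| < q^k  iff all coefficients of index ≥ k vanish.

  Small : (ℤ → Carrier) → ℤ → Set
  Small f k = ∀ j → k ℤ.≤ j → f j ≈ 0#

  -- ‖w‖ < q^k  for w ∈ F_q((x⁻¹))^d (sup norm)
  SmallV : ∀ {d} → (Fin d → ℤ → Carrier) → ℤ → Set
  SmallV w k = ∀ i → Small (w i) k

  _<N_ : ∀ {d} → (Fin d → ℤ → Carrier) → (Fin d → ℤ → Carrier) → Set
  w <N w' = ∃ λ k → SmallV w k × ¬ SmallV w' k

  _≤N_ : ∀ {d} → (Fin d → ℤ → Carrier) → (Fin d → ℤ → Carrier) → Set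
  w ≤N w' = ∀ k → SmallV w' k → SmallV w k

  record Vec+1 (d : ℕ) : Set where
    field
      num : Fin d → Poly
      den : Poly
  open Vec+1 public

  InQ : ∀ {d} → Vec+1 d → Set
  InQ u = (¬ (∀ k → coeff (den u) k ≈ 0#))
        × (∀ c → (∀ i → c ∣P num u i) → c ∣P den u → UnitP c)

  -- |v| < |u|  and  |v| ≤ |u|   (|u| = |b|)
  _<Q_ : ∀ {d} → Vec+1 d → Vec+1 d → Set
  v <Q u = ∃ λ k → Small (polyZ (den v)) k × ¬ Small (polyZ (den u)) k

  _≤Q_ : ∀ {d} → Vec+1 d → Vec+1 d → Set
  v ≤Q u = ∀ k → Small (polyZ (den u)) k → Small (polyZ (den v)) k

  Proportional : ∀ {d} → Vec+1 d → Vec+1 d → Set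
  Proportional v u = ∃ λ c → ¬ (c ≈ 0#)
    × (∀ i n → coeff (num v i) n ≈ c * coeff (num u i) n)
    × (∀ n → coeff (den v) n ≈ c * coeff (den u) n)

  -- the vector bθ - a, so that A(θ,u) = ‖err θ u‖
  err : ∀ {d} → (Fin d → Series) → Vec+1 d → Fin d → ℤ → Carrier
  err θ u i j = polySeries (den u) (θ i) j + (- polyZ (num u i) j)

  BestApprox : ∀ {d} → (Fin d → Series) → Vec+1 d → Set
  BestApprox θ u =
      (∀ v → InQ v → v <Q u → err θ u <N err θ v)
    × (∀ v → InQ v → v ≤Q u → err θ u ≤N err θ v)

  -- θ = û = a/b, i.e. b θ = a componentwise
  IsHat : ∀ {d} → Vec+1 d → (Fin d → Series) → Set
  IsHat u θ = ∀ i j → polySeries (den u) (θ i) j ≈ polyZ (num u i) j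

  -- r(u) = q^ρ, where uhat = û:
  -- q^ρ is the minimum of A(û,v) over v ∈ Q, |v| ≤ |u|, v ∉ F_q^* u.
  IsR : ∀ {d} → Vec+1 d → (Fin d → Series) → ℤ → Set
  IsR u uhat ρ =
      (∃ λ v → InQ v × v ≤Q u × ¬ Proportional v u
             × SmallV (err uhat v) (ρ ℤ.+ ℤ.+ 1) × ¬ SmallV (err uhat v) ρ)
    × (∀ v → InQ v → v ≤Q u → ¬ Proportional v u → ¬ SmallV (err uhat v) ρ)

{-# OPTIONS --safe #-}
-- Write u = (a, b) with deg b = n.  Since the leading coefficient of b is invertible,
-- |b f| = q^n |f| for every Laurent series f.  Everything rests on the identity
--   b (b′θ - a′) = b′ (bθ - a) + b (b′û - a′)     for (a′, b′) ∈ R^{d+1}, as b û = a.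
-- If A(θ, u) < r(u), any v with |v| ≤ |u| and A(θ, v) < r(u) has A(û, v) < r(u) by the identity,
-- so v ∈ F_q^* u by the definition of r(u); this gives the first inclusion.
-- Conversely let u be a best approximation and A(θ, u) = q^s with s ≥ ρ + 1, where r(u) = q^ρ.
-- If s ≥ 0, the integral part (⌊θ⌋, 1) of θ has A(θ, ·) < 1 ≤ q^s.  If s < 0, let v₀ attain
-- r(u) and let c ∈ F_q cancel the leading term of its denominator against b: w = v₀ - c u has
-- |w| < |u| and A(θ, w) < q^s by the identity (or w has denominator 0, and then v₀ ∈ F_q^* u).
-- Dividing out a common factor of the entries of w increases neither |·| nor A(θ, ·), so some
-- element of Q contradicts that u is a best approximation.
module Submission where

open import Defs
open import Data.Nat as ℕ using (ℕ; zero; suc; z≤n; s≤s)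
import Data.Nat.Properties as ℕP
open import Data.Integer as ℤ using (ℤ; +_; -[1+_]; 0ℤ; 1ℤ)
import Data.Integer.Properties as ℤP
open import Data.Integer.Tactic.RingSolver using (solve-∀)
open import Data.Fin as Fin using (Fin)
open import Data.Product using (∃; _×_; _,_; proj₁; proj₂)
open import Data.Sum using (_⊎_; inj₁; inj₂)
open import Function using (_∘_)
open import Data.Empty using (⊥; ⊥-elim)
open import Relation.Nullary using (¬_; yes; no)
open import Relation.Nullary.Decidable using (decidable-stable)
open import Relation.Binary.Definitions using (tri<; tri≈; tri>)
open import Relation.Binary.PropositionalEquality as ≡ using (_≡_; _≢_)

-- Index arithmetic on ℤ

≤-descend : ∀ (P : ℤ → Set) {m T} → (∀ {k k'} → P k → k ℤ.≤ k' → P k')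
          → (∀ s → m ℤ.≤ s → P (s ℤ.+ 1ℤ) → P s) → P T → P m
≤-descend P {m} {T} mono step PT with ℤP.≤-total m T
... | inj₂ T≤m = mono PT T≤m
... | inj₁ m≤T = go ℤ.∣ m ℤ.- T ∣ (≡.subst P (≡.sym m+∣m-T∣≡T) PT)
  where
  m+∣m-T∣≡T : m ℤ.+ + ℤ.∣ m ℤ.- T ∣ ≡ T
  m+∣m-T∣≡T = ≡.trans (≡.cong (λ z → m ℤ.+ z) (ℤP.∣-∣-≤ m≤T)) (m+[T-m]≡T m T)
    where
    m+[T-m]≡T : ∀ m T → m ℤ.+ (T ℤ.- m) ≡ T
    m+[T-m]≡T = solve-∀
  go : ∀ t → P (m ℤ.+ + t) → P m
  go zero    P0 = ≡.subst P (ℤP.+-identityʳ m) P0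
  go (suc t) P1 = go t (step (m ℤ.+ + t) (ℤP.i≤i+j m (+ t)) (≡.subst P (m+1+t≡m+t+1 m (+ t)) P1))
    where
    m+1+t≡m+t+1 : ∀ m t → m ℤ.+ (1ℤ ℤ.+ t) ≡ (m ℤ.+ t) ℤ.+ 1ℤ
    m+1+t≡m+t+1 = solve-∀

≤-split : ∀ {s j} → s ℤ.≤ j → j ≡ s ⊎ s ℤ.+ 1ℤ ℤ.≤ j
≤-split {s} {j} s≤j with j ℤ.≟ s
... | yes j≡s = inj₁ j≡s
... | no  j≢s = inj₂ (≡.subst (ℤ._≤ j) (ℤP.+-comm 1ℤ s) (ℤP.i<j⇒suc[i]≤j (ℤP.≤∧≢⇒< s≤j (λ s≡j → j≢s (≡.sym s≡j)))))

+-cancelʳ-≤ : ∀ {a b} x → a ℤ.+ x ℤ.≤ b ℤ.+ x → a ℤ.≤ b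
+-cancelʳ-≤ {a} {b} x a+x≤b+x = ≡.subst₂ ℤ._≤_ (a+x-x≡a a x) (a+x-x≡a b x) (ℤP.+-monoˡ-≤ (ℤ.- x) a+x≤b+x)
  where
  a+x-x≡a : ∀ a x → (a ℤ.+ x) ℤ.- x ≡ a
  a+x-x≡a = solve-∀

≤-sub-index : ∀ {k n m j i} → i ℕ.< n → k ℤ.+ + n ℤ.≤ m ℤ.+ 1ℤ → m ℤ.≤ j → k ℤ.≤ j ℤ.- + i
≤-sub-index {k} {n} {m} {j} {i} i<n k+n≤m+1 m≤j = +-cancelʳ-≤ (1ℤ ℤ.+ + i) (begin
  k ℤ.+ + suc i                ≤⟨ ℤP.+-monoʳ-≤ k (ℤ.+≤+ i<n) ⟩
  k ℤ.+ + n                    ≤⟨ k+n≤m+1 ⟩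
  m ℤ.+ 1ℤ                     ≤⟨ ℤP.+-monoˡ-≤ 1ℤ m≤j ⟩
  j ℤ.+ 1ℤ                     ≡⟨ j+1≡j-i+1+i j (+ i) ⟩
  (j ℤ.- + i) ℤ.+ + suc i      ∎)
  where
  open ℤP.≤-Reasoning
  j+1≡j-i+1+i : ∀ j i → j ℤ.+ 1ℤ ≡ (j ℤ.- i) ℤ.+ (1ℤ ℤ.+ i)
  j+1≡j-i+1+i = solve-∀

k+[1+n]≤k+n+1 : ∀ k n → k ℤ.+ + suc n ℤ.≤ (k ℤ.+ + n) ℤ.+ 1ℤ
k+[1+n]≤k+n+1 k n = ℤP.≤-reflexive (k+[1+n]≡k+n+1 k (+ n))
  where
  k+[1+n]≡k+n+1 : ∀ k n → k ℤ.+ (1ℤ ℤ.+ n) ≡ (k ℤ.+ n) ℤ.+ 1ℤ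
  k+[1+n]≡k+n+1 = solve-∀

k+1+n≤k+n+1 : ∀ k n → (k ℤ.+ 1ℤ) ℤ.+ + n ℤ.≤ (k ℤ.+ + n) ℤ.+ 1ℤ
k+1+n≤k+n+1 k n = ℤP.≤-reflexive (k+1+n≡k+n+1 k (+ n))
  where
  k+1+n≡k+n+1 : ∀ k n → (k ℤ.+ 1ℤ) ℤ.+ n ≡ (k ℤ.+ n) ℤ.+ 1ℤ
  k+1+n≡k+n+1 = solve-∀

module _ (F : FiniteField) where
  open FiniteField F
  open import Algebra.Properties.Ring ring using (x[y-z]≈xy-xz; [y-z]x≈yx-zx)
  open import Algebra.Properties.AbelianGroup +-abelianGroup using (⁻¹-∙-comm; xyx⁻¹≈y)
  open import Algebra.Properties.Group +-group using (//-cong₂; x∙y⁻¹≈ε⇒x≈y)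
  open import Algebra.Properties.CommutativeSemigroup +-commutativeSemigroup using (interchange)
  open import Algebra.Properties.CommutativeSemigroup *-commutativeSemigroup using (x∙yz≈y∙xz)
  open import Relation.Binary.Reasoning.Setoid setoid

  x≉0∧x*y≈0⇒y≈0 : ∀ {x y} → ¬ x ≈ 0# → x * y ≈ 0# → y ≈ 0#
  x≉0∧x*y≈0⇒y≈0 {x} {y} x≉0 xy≈0 with inverse x x≉0
  ... | x⁻¹ , xx⁻¹≈1 = begin
    y                ≈⟨ sym (*-identityˡ y) ⟩
    1# * y           ≈⟨ *-congʳ (sym (trans (*-comm x⁻¹ x) xx⁻¹≈1)) ⟩
    (x⁻¹ * x) * y    ≈⟨ *-assoc x⁻¹ x y ⟩
    x⁻¹ * (x * y)    ≈⟨ *-congˡ xy≈0 ⟩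
    x⁻¹ * 0#         ≈⟨ zeroʳ x⁻¹ ⟩
    0#               ∎

  [a+b]-[c+d]≈[a-c]+[b-d] : ∀ a b c d → (a + b) - (c + d) ≈ (a - c) + (b - d)
  [a+b]-[c+d]≈[a-c]+[b-d] a b c d = begin
    (a + b) - (c + d)       ≈⟨ +-congˡ (sym (⁻¹-∙-comm c d)) ⟩
    (a + b) + (- c + - d)   ≈⟨ interchange a b (- c) (- d) ⟩
    (a - c) + (b - d)       ∎

  [a-b]-[c-d]≈[a-c]-[b-d] : ∀ a b c d → (a - b) - (c - d) ≈ (a - c) - (b - d)
  [a-b]-[c-d]≈[a-c]-[b-d] a b c d = begin
    (a - b) + - (c - d)       ≈⟨ +-congˡ (sym (⁻¹-∙-comm c (- d))) ⟩
    (a - b) + (- c + - - d)   ≈⟨ interchange a (- b) (- c) (- - d) ⟩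
    (a - c) + (- b + - - d)   ≈⟨ +-congˡ (⁻¹-∙-comm b (- d)) ⟩
    (a - c) - (b - d)         ∎

  [a-b]+[b-c]≈a-c : ∀ a b c → (a - b) + (b - c) ≈ a - c
  [a-b]+[b-c]≈a-c a b c = begin
    (a - b) + (b - c)         ≈⟨ +-assoc a (- b) (b - c) ⟩
    a + (- b + (b - c))       ≈⟨ +-congˡ (+-assoc (- b) b (- c)) ⟨
    a + ((- b + b) - c)       ≈⟨ +-congˡ (+-congʳ (-‿inverseˡ b)) ⟩
    a + (0# - c)              ≈⟨ +-congˡ (+-identityˡ (- c)) ⟩
    a - c                     ∎

  x≈y+z⇒z≈x-y : ∀ {x y z} → x ≈ y + z → z ≈ x - y
  x≈y+z⇒z≈x-y {x} {y} {z} x≈y+z = trans (sym (xyx⁻¹≈y y z)) (//-cong₂ (sym x≈y+z) refl)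

  0-0≈0 : 0# - 0# ≈ 0#
  0-0≈0 = -‿inverseʳ 0#

  -- Finite sums

  ∑ : ℕ → (ℕ → Carrier) → Carrier
  ∑ = sumF F

  ∑-cong : ∀ n {f g} → (∀ i → i ℕ.< n → f i ≈ g i) → ∑ n f ≈ ∑ n g
  ∑-cong zero    f≈g = refl
  ∑-cong (suc n) f≈g = +-cong (∑-cong n (λ i i<n → f≈g i (ℕP.m<n⇒m<1+n i<n))) (f≈g n (ℕP.n<1+n n))

  ∑-zero : ∀ n {f} → (∀ i → i ℕ.< n → f i ≈ 0#) → ∑ n f ≈ 0#
  ∑-zero zero    f≈0 = refl
  ∑-zero (suc n) f≈0 = trans (+-cong (∑-zero n (λ i i<n → f≈0 i (ℕP.m<n⇒m<1+n i<n))) (f≈0 n (ℕP.n<1+n n))) (+-identityˡ 0#)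

  ∑-distrib-- : ∀ n (f g : ℕ → Carrier) → ∑ n (λ i → f i - g i) ≈ ∑ n f - ∑ n g
  ∑-distrib-- zero    f g = sym 0-0≈0
  ∑-distrib-- (suc n) f g = trans (+-congʳ (∑-distrib-- n f g)) (sym ([a+b]-[c+d]≈[a-c]+[b-d] _ _ _ _))

  *-distribˡ-∑ : ∀ n c (f : ℕ → Carrier) → c * ∑ n f ≈ ∑ n (λ i → c * f i)
  *-distribˡ-∑ zero    c f = zeroʳ c
  *-distribˡ-∑ (suc n) c f = trans (distribˡ c _ _) (+-congʳ (*-distribˡ-∑ n c f))

  ∑-comm : ∀ n m (g : ℕ → ℕ → Carrier) → ∑ n (λ i → ∑ m (g i)) ≈ ∑ m (λ j → ∑ n (λ i → g i j))
  ∑-comm zero    m g = sym (∑-zero m (λ _ _ → refl))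
  ∑-comm (suc n) m g = trans (+-congʳ (∑-comm n m g)) (sym (∑-distrib-+ m))
    where
    ∑-distrib-+ : ∀ m → ∑ m (λ j → ∑ n (λ i → g i j) + g n j) ≈ ∑ m (λ j → ∑ n (λ i → g i j)) + ∑ m (g n)
    ∑-distrib-+ zero    = sym (+-identityˡ 0#)
    ∑-distrib-+ (suc m) = trans (+-congʳ (∑-distrib-+ m)) (interchange _ _ _ _)

  ∑-extend : ∀ {p} n f → (∀ i → p ℕ.≤ i → f i ≈ 0#) → p ℕ.≤ n → ∑ n f ≈ ∑ p f
  ∑-extend zero    f f≈0 z≤n = refl
  ∑-extend (suc n) f f≈0 p≤1+n with ℕP.m≤n⇒m<n∨m≡n p≤1+n
  ... | inj₂ ≡.refl = refl
  ... | inj₁ p<1+n  = trans (+-cong (∑-extend n f f≈0 (ℕP.≤-pred p<1+n)) (f≈0 n (ℕP.≤-pred p<1+n))) (+-identityʳ _)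

  ∑-single : ∀ n m f → m ℕ.< n → (∀ i → i ℕ.< n → i ≢ m → f i ≈ 0#) → ∑ n f ≈ f m
  ∑-single (suc n) m f m<1+n f≈0 with ℕP.m≤n⇒m<n∨m≡n (ℕP.≤-pred m<1+n)
  ... | inj₂ ≡.refl = trans (+-congʳ (∑-zero n (λ i i<n → f≈0 i (ℕP.m<n⇒m<1+n i<n) (ℕP.<⇒≢ i<n)))) (+-identityˡ _)
  ... | inj₁ m<n    = trans (+-cong (∑-single n m f m<n (λ i i<n → f≈0 i (ℕP.m<n⇒m<1+n i<n)))
                                   (f≈0 n (ℕP.n<1+n n) (λ n≡m → ℕP.<⇒≢ m<n (≡.sym n≡m))))
                            (+-identityʳ _)

  -- Polynomials acting on Laurent series

  conv : ℕ → (ℕ → Carrier) → (ℤ → Carrier) → ℤ → Carrier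
  conv L b f k = ∑ L (λ i → b i * f (k ℤ.- + i))

  -- polySeries F p θ is definitionally p ⋆ scoeff θ.
  _⋆_ : Poly F → (ℤ → Carrier) → ℤ → Carrier
  p ⋆ f = conv (len p) (coeff p) f

  conv-congˡ : ∀ L {b b'} f → (∀ i → b i ≈ b' i) → ∀ k → conv L b f k ≈ conv L b' f k
  conv-congˡ L f b≈b' k = ∑-cong L (λ i _ → *-congʳ (b≈b' i))

  conv-congʳ : ∀ L b {f g} → (∀ k → f k ≈ g k) → ∀ k → conv L b f k ≈ conv L b g k
  conv-congʳ L b f≈g k = ∑-cong L (λ i _ → *-congˡ (f≈g _))

  conv-distribˡ-- : ∀ L b b' f k → conv L (λ i → b i - b' i) f k ≈ conv L b f k - conv L b' f k
  conv-distribˡ-- L b b' f k = trans (∑-cong L (λ i _ → [y-z]x≈yx-zx _ _ _)) (∑-distrib-- L _ _)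

  conv-distribʳ-- : ∀ L b f g k → conv L b (λ j → f j - g j) k ≈ conv L b f k - conv L b g k
  conv-distribʳ-- L b f g k = trans (∑-cong L (λ i _ → x[y-z]≈xy-xz _ _ _)) (∑-distrib-- L _ _)

  conv-scaleˡ : ∀ L c b f k → conv L (λ i → c * b i) f k ≈ c * conv L b f k
  conv-scaleˡ L c b f k = trans (∑-cong L (λ i _ → *-assoc _ _ _)) (sym (*-distribˡ-∑ L c _))

  conv-zeroˡ : ∀ L {b} f → (∀ i → b i ≈ 0#) → ∀ k → conv L b f k ≈ 0#
  conv-zeroˡ L f b≈0 k = ∑-zero L (λ i _ → trans (*-congʳ (b≈0 i)) (zeroˡ _))

  conv-zeroʳ : ∀ L b {f} → (∀ k → f k ≈ 0#) → ∀ k → conv L b f k ≈ 0#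
  conv-zeroʳ L b f≈0 k = ∑-zero L (λ i _ → trans (*-congˡ (f≈0 _)) (zeroʳ _))

  conv-extend : ∀ (p : Poly F) {L} f k → len p ℕ.≤ L → conv L (coeff p) f k ≈ (p ⋆ f) k
  conv-extend p f k len≤L = ∑-extend _ _ (λ i len≤i → trans (*-congʳ (vanish p i len≤i)) (zeroˡ _)) len≤L

  conv-comm : ∀ L b L' b' f k → conv L b (conv L' b' f) k ≈ conv L' b' (conv L b f) k
  conv-comm L b L' b' f k = begin
    ∑ L (λ i → b i * ∑ L' (λ j → b' j * f ((k ℤ.- + i) ℤ.- + j)))
      ≈⟨ ∑-cong L (λ i _ → *-distribˡ-∑ L' (b i) _) ⟩
    ∑ L (λ i → ∑ L' (λ j → b i * (b' j * f ((k ℤ.- + i) ℤ.- + j))))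
      ≈⟨ ∑-comm L L' _ ⟩
    ∑ L' (λ j → ∑ L (λ i → b i * (b' j * f ((k ℤ.- + i) ℤ.- + j))))
      ≈⟨ ∑-cong L' (λ j _ → ∑-cong L (λ i _ → trans (x∙yz≈y∙xz _ _ _) (*-congˡ (*-congˡ (reflexive (≡.cong f (k-i-j≡k-j-i k (+ i) (+ j)))))))) ⟩
    ∑ L' (λ j → ∑ L (λ i → b' j * (b i * f ((k ℤ.- + j) ℤ.- + i))))
      ≈⟨ ∑-cong L' (λ j _ → sym (*-distribˡ-∑ L (b' j) _)) ⟩
    ∑ L' (λ j → b' j * ∑ L (λ i → b i * f ((k ℤ.- + j) ℤ.- + i)))  ∎
    where
    k-i-j≡k-j-i : ∀ k i j → (k ℤ.- i) ℤ.- j ≡ (k ℤ.- j) ℤ.- i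
    k-i-j≡k-j-i = solve-∀

  ⋆-comm : ∀ (p q : Poly F) f k → (p ⋆ (q ⋆ f)) k ≈ (q ⋆ (p ⋆ f)) k
  ⋆-comm p q = conv-comm (len p) (coeff p) (len q) (coeff q)

  ⋆-congʳ : ∀ (p : Poly F) {f g} → (∀ k → f k ≈ g k) → ∀ k → (p ⋆ f) k ≈ (p ⋆ g) k
  ⋆-congʳ p = conv-congʳ (len p) (coeff p)

  ⋆-distribʳ-- : ∀ (p : Poly F) f g k → (p ⋆ (λ j → f j - g j)) k ≈ (p ⋆ f) k - (p ⋆ g) k
  ⋆-distribʳ-- p = conv-distribʳ-- (len p) (coeff p)

  _-[_]·_ : Poly F → Carrier → Poly F → Poly F
  p -[ c ]· q = record
    { coeff  = λ n → coeff p n - c * coeff q n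
    ; len    = len p ℕ.+ len q
    ; vanish = λ n len≤n → trans (//-cong₂ (vanish p n (ℕP.≤-trans (ℕP.m≤m+n _ _) len≤n))
                                             (trans (*-congˡ (vanish q n (ℕP.≤-trans (ℕP.m≤n+m _ _) len≤n))) (zeroʳ c)))
                                 0-0≈0
    }

  ⋆-scaleˡ : ∀ p q c → (∀ n → coeff p n ≈ c * coeff q n) → ∀ f k → (p ⋆ f) k ≈ c * (q ⋆ f) k
  ⋆-scaleˡ p q c p≈cq f k = begin
    (p ⋆ f) k                     ≈⟨ conv-extend p f k (ℕP.m≤m+n _ _) ⟨
    conv L (coeff p) f k          ≈⟨ conv-congˡ L f p≈cq k ⟩
    conv L (λ n → c * coeff q n) f k ≈⟨ conv-scaleˡ L c _ f k ⟩
    c * conv L (coeff q) f k      ≈⟨ *-congˡ (conv-extend q f k (ℕP.m≤n+m (len q) (len p))) ⟩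
    c * (q ⋆ f) k                 ∎
    where
    L = len p ℕ.+ len q

  ⋆-sub-scaledˡ : ∀ p c q f k → ((p -[ c ]· q) ⋆ f) k ≈ (p ⋆ f) k - c * (q ⋆ f) k
  ⋆-sub-scaledˡ p c q f k = begin
    conv L (λ n → coeff p n - c * coeff q n) f k              ≈⟨ conv-distribˡ-- L _ _ f k ⟩
    conv L (coeff p) f k - conv L (λ n → c * coeff q n) f k   ≈⟨ //-cong₂ refl (conv-scaleˡ L c _ f k) ⟩
    conv L (coeff p) f k - c * conv L (coeff q) f k
      ≈⟨ //-cong₂ (conv-extend p f k (ℕP.m≤m+n _ _)) (*-congˡ (conv-extend q f k (ℕP.m≤n+m (len q) (len p)))) ⟩
    (p ⋆ f) k - c * (q ⋆ f) k                                 ∎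
    where
    L = len p ℕ.+ len q

  -- Viewing a polynomial p as p ⋆ δ turns commutativity of polynomial products into conv-comm.
  δ : ℤ → Carrier
  δ (+ zero)  = 1#
  δ (+ suc _) = 0#
  δ -[1+ _ ]  = 0#

  δ[k-i]≈0 : ∀ {k i} → k ≢ + i → δ (k ℤ.- + i) ≈ 0#
  δ[k-i]≈0 {k} {i} k≢i with k ℤ.- + i in eq
  ... | + zero  = ⊥-elim (k≢i (ℤP.i-j≡0⇒i≡j k (+ i) eq))
  ... | + suc _ = refl
  ... | -[1+ _ ] = refl

  polyZ≈⋆δ : ∀ (p : Poly F) k → polyZ F p k ≈ (p ⋆ δ) k
  polyZ≈⋆δ p -[1+ n ] = sym (∑-zero (len p) (λ i _ → trans (*-congˡ (δ[k-i]≈0 { -[1+ n ]} {i} (λ ()))) (zeroʳ _)))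
  polyZ≈⋆δ p (+ n) = begin
    coeff p n                             ≈⟨ *-identityʳ _ ⟨
    coeff p n * 1#                        ≈⟨ *-congˡ (reflexive (≡.cong δ (ℤP.+-inverseʳ (+ n)))) ⟨
    coeff p n * δ (+ n ℤ.- + n)           ≈⟨ ∑-single L n _ (ℕP.m≤n+m (suc n) (len p)) off-diagonal ⟨
    conv L (coeff p) δ (+ n)              ≈⟨ conv-extend p δ (+ n) (ℕP.m≤m+n (len p) (suc n)) ⟩
    (p ⋆ δ) (+ n)                         ∎
    where
    L = len p ℕ.+ suc n
    off-diagonal : ∀ i → i ℕ.< L → i ≢ n → coeff p i * δ (+ n ℤ.- + i) ≈ 0#
    off-diagonal i _ i≢n = trans (*-congˡ (δ[k-i]≈0 (λ n≡i → i≢n (≡.sym (ℤP.+-injective n≡i))))) (zeroʳ _)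

  ⋆-polyZ-comm : ∀ (p q : Poly F) k → (p ⋆ polyZ F q) k ≈ (q ⋆ polyZ F p) k
  ⋆-polyZ-comm p q k = begin
    (p ⋆ polyZ F q) k   ≈⟨ ⋆-congʳ p (polyZ≈⋆δ q) k ⟩
    (p ⋆ (q ⋆ δ)) k     ≈⟨ ⋆-comm p q δ k ⟩
    (q ⋆ (p ⋆ δ)) k     ≈⟨ ⋆-congʳ q (polyZ≈⋆δ p) k ⟨
    (q ⋆ polyZ F p) k   ∎

  polyZ-neg : ∀ (p : Poly F) {k} → k ℤ.< 0ℤ → polyZ F p k ≈ 0#
  polyZ-neg p { -[1+ _ ]} _ = refl
  polyZ-neg p {+ _} k<0 = ⊥-elim (ℤP.+≮0 k<0)

  n-i<0 : ∀ {n i} → n ℕ.< i → + n ℤ.- + i ℤ.< 0ℤ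
  n-i<0 {n} {i} n<i = ≡.subst (+ n ℤ.- + i ℤ.<_) (ℤP.+-inverseʳ (+ i)) (ℤP.+-monoˡ-< (ℤ.- + i) (ℤ.+<+ n<i))

  polyMul≈⋆ : ∀ (c e p : Poly F) → (∀ n → polyMulCoeff F c e n ≈ coeff p n)
            → ∀ k → polyZ F p k ≈ (c ⋆ polyZ F e) k
  polyMul≈⋆ c e p ce≈p -[1+ n ] = sym (∑-zero (len c) (λ i _ →
    trans (*-congˡ (reflexive (≡.cong (polyZ F e) (ℤP.neg-minus-pos n i)))) (zeroʳ _)))
  polyMul≈⋆ c e p ce≈p (+ n) = begin
    coeff p n                       ≈⟨ ce≈p n ⟨
    polyMulCoeff F c e n            ≈⟨ ∑-cong (suc n) (λ i i≤n → *-congˡ (reflexive (≡.cong (polyZ F e) (≡.sym (n-i≡n∸i (ℕP.≤-pred i≤n)))))) ⟩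
    ∑ (suc n) term                  ≈⟨ ∑-extend L term term≈0-above-n (ℕP.m≤m+n (suc n) (len c)) ⟨
    ∑ L term                        ≈⟨ ∑-extend L term (λ i len≤i → trans (*-congʳ (vanish c i len≤i)) (zeroˡ _)) (ℕP.m≤n+m (len c) (suc n)) ⟩
    (c ⋆ polyZ F e) (+ n)           ∎
    where
    L = suc n ℕ.+ len c
    term : ℕ → Carrier
    term i = coeff c i * polyZ F e (+ n ℤ.- + i)
    n-i≡n∸i : ∀ {i} → i ℕ.≤ n → + n ℤ.- + i ≡ + (n ℕ.∸ i)
    n-i≡n∸i {i} i≤n = ≡.trans (ℤP.m-n≡m⊖n n i) (ℤP.⊖-≥ i≤n)
    term≈0-above-n : ∀ i → suc n ℕ.≤ i → term i ≈ 0#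
    term≈0-above-n i n<i = trans (*-congˡ (polyZ-neg e (n-i<0 {n} {i} n<i))) (zeroʳ _)

  -- Valuations

  Bounded : (ℤ → Carrier) → Set
  Bounded f = ∃ (Small F f)

  small-mono : ∀ {f k k'} → Small F f k → k ℤ.≤ k' → Small F f k'
  small-mono small k≤k' j k'≤j = small j (ℤP.≤-trans k≤k' k'≤j)

  smallV-mono : ∀ {d} {w : Fin d → ℤ → Carrier} {k k'} → SmallV F w k → k ℤ.≤ k' → SmallV F w k'
  smallV-mono small k≤k' i = small-mono (small i) k≤k'

  small-cong : ∀ {f g k} → (∀ j → f j ≈ g j) → Small F f k → Small F g k
  small-cong f≈g small j k≤j = trans (sym (f≈g j)) (small j k≤j)

  small-+ : ∀ {f g k} → Small F f k → Small F g k → Small F (λ j → f j + g j) k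
  small-+ f-small g-small j k≤j = trans (+-cong (f-small j k≤j) (g-small j k≤j)) (+-identityˡ 0#)

  small-- : ∀ {f g k} → Small F f k → Small F g k → Small F (λ j → f j - g j) k
  small-- f-small g-small j k≤j = trans (//-cong₂ (f-small j k≤j) (g-small j k≤j)) 0-0≈0

  smallV-stable : ∀ {d} {w : Fin d → ℤ → Carrier} {k} → ¬ ¬ SmallV F w k → SmallV F w k
  smallV-stable {w = w} ¬¬small i j k≤j =
    decidable-stable (w i j ≟F 0#) (λ wij≉0 → ¬¬small (λ small → wij≉0 (small i j k≤j)))

  DegreeBelow : Poly F → ℕ → Set
  DegreeBelow p n = ∀ i → n ℕ.≤ i → coeff p i ≈ 0#

  degree-below⇒small : ∀ {p n} → DegreeBelow p n → Small F (polyZ F p) (+ n)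
  degree-below⇒small below (+ i)    n≤i = below i (ℤP.drop‿+≤+ n≤i)
  degree-below⇒small below -[1+ i ] _   = refl

  small⇒degree-below : ∀ {p n} → Small F (polyZ F p) (+ n) → DegreeBelow p n
  small⇒degree-below small i n≤i = small (+ i) (ℤ.+≤+ n≤i)

  degree-below-mono : ∀ p {m n} → DegreeBelow p m → m ℕ.≤ n → DegreeBelow p n
  degree-below-mono p below m≤n i n≤i = below i (ℕP.≤-trans m≤n n≤i)

  record Degree (p : Poly F) (n : ℕ) : Set where
    field
      lead≉0 : ¬ coeff p n ≈ 0#
      below  : DegreeBelow p (suc n)

  degree-below⇒< : ∀ {p n m} → Degree p n → DegreeBelow p m → n ℕ.< m
  degree-below⇒< {p} {n} {m} deg below with n ℕ.<? m
  ... | yes n<m = n<m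
  ... | no  n≮m = ⊥-elim (Degree.lead≉0 deg (below n (ℕP.≮⇒≥ n≮m)))

  degree? : ∀ p → (∀ k → coeff p k ≈ 0#) ⊎ ∃ (Degree p)
  degree? p = search (len p) (vanish p)
    where
    search : ∀ m → DegreeBelow p m → (∀ k → coeff p k ≈ 0#) ⊎ ∃ (Degree p)
    search zero    below = inj₁ (λ k → below k z≤n)
    search (suc m) below with coeff p m ≟F 0#
    ... | no  pm≉0 = inj₂ (m , record { lead≉0 = pm≉0 ; below = below })
    ... | yes pm≈0 = search m below′
      where
      below′ : DegreeBelow p m
      below′ i m≤i with ℕP.m≤n⇒m<n∨m≡n m≤i
      ... | inj₁ m<i    = below i m<i
      ... | inj₂ ≡.refl = pm≈0

  ⋆-small : ∀ p {n f k m} → DegreeBelow p n → Small F f k → k ℤ.+ + n ℤ.≤ m ℤ.+ 1ℤ → Small F (p ⋆ f) m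
  ⋆-small p {n} below f-small k+n≤m+1 j m≤j = ∑-zero (len p) term≈0
    where
    term≈0 : ∀ i → i ℕ.< len p → coeff p i * _ ≈ 0#
    term≈0 i _ with n ℕ.≤? i
    ... | yes n≤i = trans (*-congʳ (below i n≤i)) (zeroˡ _)
    ... | no  n≰i = trans (*-congˡ (f-small _ (≤-sub-index (ℕP.≰⇒> n≰i) k+n≤m+1 m≤j))) (zeroʳ _)

  lead-cancel : ∀ {p n f k} → Degree p n → Bounded f → Small F (p ⋆ f) (k ℤ.+ + n) → Small F f k
  lead-cancel {p} {n} {f} {k} deg (T , f-small) pf-small = ≤-descend (Small F f) small-mono step f-small
    where
    open Degree deg
    -- Once f vanishes above s, (p ⋆ f)(s + n) = lead(p) · f(s).
    step : ∀ s → k ℤ.≤ s → Small F f (s ℤ.+ 1ℤ) → Small F f s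
    step s k≤s f-small′ j s≤j with ≤-split s≤j
    ... | inj₂ s+1≤j  = f-small′ j s+1≤j
    ... | inj₁ ≡.refl = x≉0∧x*y≈0⇒y≈0 lead≉0 (begin
      coeff p n * f s                        ≈⟨ *-congˡ (reflexive (≡.cong f (s+n-n≡s s (+ n)))) ⟨
      coeff p n * f ((s ℤ.+ + n) ℤ.- + n)    ≈⟨ ∑-single (len p) n _ (degree-below⇒< deg (vanish p)) off-lead ⟨
      (p ⋆ f) (s ℤ.+ + n)                    ≈⟨ pf-small _ (ℤP.+-monoˡ-≤ (+ n) k≤s) ⟩
      0#                                     ∎)
      where
      s+n-n≡s : ∀ s n → (s ℤ.+ n) ℤ.- n ≡ s
      s+n-n≡s = solve-∀
      s+1+n≡s+n+1 : ∀ s n → (s ℤ.+ 1ℤ) ℤ.+ n ≡ (s ℤ.+ n) ℤ.+ 1ℤ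
      s+1+n≡s+n+1 = solve-∀
      off-lead : ∀ i → i ℕ.< len p → i ≢ n → coeff p i * f ((s ℤ.+ + n) ℤ.- + i) ≈ 0#
      off-lead i _ i≢n with ℕP.<-cmp i n
      ... | tri< i<n _ _ = trans (*-congˡ (f-small′ _ (≤-sub-index {m = s ℤ.+ + n} i<n (ℤP.≤-reflexive (s+1+n≡s+n+1 s (+ n))) ℤP.≤-refl))) (zeroʳ _)
      ... | tri≈ _ i≡n _ = ⊥-elim (i≢n i≡n)
      ... | tri> _ _ n<i = trans (*-congʳ (below i n<i)) (zeroˡ _)

  series-small : ∀ (s : Series F) → Small F (scoeff s) (ℤ.suc (top s))
  series-small s j top<j = svanish s j (ℤP.suc[i]≤j⇒i<j top<j)

  err-bounded : ∀ {d} θ (w : Vec+1 F d) i → Bounded (err F θ w i)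
  err-bounded θ w i = M ℤ.⊔ + len (num w i) ,
    small-- (small-mono (⋆-small (den w) (vanish (den w)) (series-small (θ i)) (ℤP.i≤i+j M 1ℤ)) (ℤP.i≤i⊔j _ _))
            (small-mono (degree-below⇒small (vanish (num w i))) (ℤP.i≤j⊔i _ _))
    where
    M = ℤ.suc (top (θ i)) ℤ.+ + len (den w)

  boundedV : ∀ {d} (w : Fin d → ℤ → Carrier) → (∀ i → Bounded (w i)) → ∃ (SmallV F w)
  boundedV {zero}  w bounded = 0ℤ , λ ()
  boundedV {suc d} w bounded with bounded Fin.zero | boundedV (λ i → w (Fin.suc i)) (λ i → bounded (Fin.suc i))
  ... | T₀ , small₀ | T , small = T₀ ℤ.⊔ T , λ where
    Fin.zero    → small-mono small₀ (ℤP.i≤i⊔j T₀ T)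
    (Fin.suc i) → small-mono (small i) (ℤP.i≤j⊔i T₀ T)

  -- Approximation errors

  _-[_]·ᵥ_ : ∀ {d} → Vec+1 F d → Carrier → Vec+1 F d → Vec+1 F d
  v -[ c ]·ᵥ u = record { num = λ i → num v i -[ c ]· num u i ; den = den v -[ c ]· den u }

  polyZ-sub-scaled : ∀ p c q k → polyZ F (p -[ c ]· q) k ≈ polyZ F p k - c * polyZ F q k
  polyZ-sub-scaled p c q (+ n)    = refl
  polyZ-sub-scaled p c q -[1+ n ] = sym (trans (//-cong₂ refl (zeroʳ c)) 0-0≈0)

  polyZ-scale : ∀ {p q} c → (∀ n → coeff p n ≈ c * coeff q n) → ∀ k → polyZ F p k ≈ c * polyZ F q k
  polyZ-scale c p≈cq (+ n)    = p≈cq n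
  polyZ-scale c p≈cq -[1+ n ] = sym (zeroʳ c)

  err-scale : ∀ {d} θ (v u : Vec+1 F d) c
            → (∀ i n → coeff (num v i) n ≈ c * coeff (num u i) n) → (∀ n → coeff (den v) n ≈ c * coeff (den u) n)
            → ∀ i k → err F θ v i k ≈ c * err F θ u i k
  err-scale θ v u c num≈ den≈ i k =
    trans (//-cong₂ (⋆-scaleˡ (den v) (den u) c den≈ (scoeff (θ i)) k) (polyZ-scale c (num≈ i) k)) (sym (x[y-z]≈xy-xz c _ _))

  err-sub-scaled : ∀ {d} θ (v : Vec+1 F d) c u i k → err F θ (v -[ c ]·ᵥ u) i k ≈ err F θ v i k - c * err F θ u i k
  err-sub-scaled θ v c u i k = begin
    err F θ (v -[ c ]·ᵥ u) i k
      ≈⟨ //-cong₂ (⋆-sub-scaledˡ (den v) c (den u) t k) (polyZ-sub-scaled (num v i) c (num u i) k) ⟩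
    ((den v ⋆ t) k - c * (den u ⋆ t) k) - (polyZ F (num v i) k - c * polyZ F (num u i) k)
      ≈⟨ [a-b]-[c-d]≈[a-c]-[b-d] _ _ _ _ ⟩
    err F θ v i k - (c * (den u ⋆ t) k - c * polyZ F (num u i) k)
      ≈⟨ //-cong₂ refl (x[y-z]≈xy-xz c _ _) ⟨
    err F θ v i k - c * err F θ u i k ∎
    where
    t = scoeff (θ i)

  err-transfer : ∀ {d} {u : Vec+1 F d} {uhat} → IsHat F u uhat → ∀ θ w i k
               → (den u ⋆ err F θ w i) k ≈ (den w ⋆ err F θ u i) k + (den u ⋆ err F uhat w i) k
  err-transfer {u = u} {uhat} hat θ w i k = sym (begin
    (W ⋆ err F θ u i) k + (B ⋆ err F uhat w i) k
      ≈⟨ +-cong (⋆-distribʳ-- W (B ⋆ t) a k) (⋆-distribʳ-- B (W ⋆ h) a′ k) ⟩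
    ((W ⋆ (B ⋆ t)) k - (W ⋆ a) k) + ((B ⋆ (W ⋆ h)) k - (B ⋆ a′) k)
      ≈⟨ +-congˡ (//-cong₂ (trans (⋆-comm B W h k) (⋆-congʳ W (hat i) k)) refl) ⟩
    ((W ⋆ (B ⋆ t)) k - (W ⋆ a) k) + ((W ⋆ a) k - (B ⋆ a′) k)
      ≈⟨ [a-b]+[b-c]≈a-c _ _ _ ⟩
    (W ⋆ (B ⋆ t)) k - (B ⋆ a′) k
      ≈⟨ //-cong₂ (⋆-comm W B t k) refl ⟩
    (B ⋆ (W ⋆ t)) k - (B ⋆ a′) k
      ≈⟨ ⋆-distribʳ-- B (W ⋆ t) a′ k ⟨
    (B ⋆ err F θ w i) k ∎)
    where
    B = den u
    W = den w
    t = scoeff (θ i)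
    h = scoeff (uhat i)
    a = polyZ F (num u i)
    a′ = polyZ F (num w i)

  quotient : ∀ {d} c (w : Vec+1 F d) → (∀ i → _∣P_ F c (num w i)) → _∣P_ F c (den w) → Vec+1 F d
  quotient c w c∣a c∣b = record { num = λ i → proj₁ (c∣a i) ; den = proj₁ c∣b }

  -- For b′ = c e and a′ = c e′ this is e (b′θ - a′) = b′ (eθ - e′), rather than b′θ - a′ = c (eθ - e′):
  -- that form only needs polynomial factors to commute, not associativity of ⋆ with polynomial products.
  err-quotient : ∀ {d} θ c (w : Vec+1 F d) (c∣a : ∀ i → _∣P_ F c (num w i)) (c∣b : _∣P_ F c (den w)) i k
               → (den (quotient c w c∣a c∣b) ⋆ err F θ w i) k ≈ (den w ⋆ err F θ (quotient c w c∣a c∣b) i) k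
  err-quotient θ c w c∣a c∣b i k = begin
    (e ⋆ err F θ w i) k                   ≈⟨ ⋆-distribʳ-- e (W ⋆ t) (polyZ F a′) k ⟩
    (e ⋆ (W ⋆ t)) k - (e ⋆ polyZ F a′) k  ≈⟨ //-cong₂ (⋆-comm e W t k) numerators ⟩
    (W ⋆ (e ⋆ t)) k - (W ⋆ polyZ F e′) k  ≈⟨ ⋆-distribʳ-- W (e ⋆ t) (polyZ F e′) k ⟨
    (W ⋆ err F θ (quotient c w c∣a c∣b) i) k ∎
    where
    W = den w
    a′ = num w i
    e = proj₁ c∣b
    e′ = proj₁ (c∣a i)
    t = scoeff (θ i)
    numerators : (e ⋆ polyZ F a′) k ≈ (W ⋆ polyZ F e′) k
    numerators = begin
      (e ⋆ polyZ F a′) k          ≈⟨ ⋆-congʳ e (polyMul≈⋆ c e′ a′ (proj₂ (c∣a i))) k ⟩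
      (e ⋆ (c ⋆ polyZ F e′)) k    ≈⟨ ⋆-comm e c (polyZ F e′) k ⟩
      (c ⋆ (e ⋆ polyZ F e′)) k    ≈⟨ ⋆-congʳ c (⋆-polyZ-comm e e′) k ⟩
      (c ⋆ (e′ ⋆ polyZ F e)) k    ≈⟨ ⋆-comm c e′ (polyZ F e) k ⟩
      (e′ ⋆ (c ⋆ polyZ F e)) k    ≈⟨ ⋆-congʳ e′ (polyMul≈⋆ c e W (proj₂ c∣b)) k ⟨
      (e′ ⋆ polyZ F W) k          ≈⟨ ⋆-polyZ-comm e′ W k ⟩
      (W ⋆ polyZ F e′) k          ∎

  -- Clearing common divisors

  constant-unit : ∀ {c} → Degree c 0 → UnitP F c
  constant-unit {c} deg with inverse (coeff c 0) (Degree.lead≉0 deg)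
  ... | c₀⁻¹ , c₀c₀⁻¹≈1 = c⁻¹ , cc⁻¹≈1
    where
    c⁻¹ : Poly F
    c⁻¹ = record { coeff = λ { zero → c₀⁻¹ ; (suc _) → 0# } ; len = 1 ; vanish = λ { (suc _) _ → refl } }
    cc⁻¹≈1 : ∀ k → polyMulCoeff F c c⁻¹ k ≈ oneCoeff F k
    cc⁻¹≈1 zero    = trans (+-identityˡ _) c₀c₀⁻¹≈1
    cc⁻¹≈1 (suc k) = ∑-zero (suc (suc k)) λ where
      zero    _ → zeroʳ _
      (suc i) _ → trans (*-congʳ (Degree.below deg (suc i) (s≤s z≤n))) (zeroˡ _)

  divisor-zero : ∀ c p → _∣P_ F c p → (∀ k → coeff c k ≈ 0#) → ∀ k → coeff p k ≈ 0#
  divisor-zero c p (e , ce≈p) c≈0 k = trans (polyMul≈⋆ c e p ce≈p (+ k)) (conv-zeroˡ (len c) (polyZ F e) c≈0 (+ k))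

  cofactor-zero : ∀ c p ((e , _) : _∣P_ F c p) → (∀ k → coeff e k ≈ 0#) → ∀ k → coeff p k ≈ 0#
  cofactor-zero c p (e , ce≈p) e≈0 k = trans (polyMul≈⋆ c e p ce≈p (+ k)) (conv-zeroʳ (len c) (coeff c) e≈0′ (+ k))
    where
    e≈0′ : ∀ j → polyZ F e j ≈ 0#
    e≈0′ (+ j)    = e≈0 j
    e≈0′ -[1+ j ] = refl

  cofactor-small : ∀ {c m} p ((e , _) : _∣P_ F c p) {k} → Degree c m
                 → Small F (polyZ F p) (k ℤ.+ + m) → Small F (polyZ F e) k
  cofactor-small {c} p (e , ce≈p) deg p-small =
    lead-cancel deg (+ len e , degree-below⇒small (vanish e)) (small-cong (polyMul≈⋆ c e p ce≈p) p-small)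

  -- Dividing out a common divisor of positive degree lowers the degree of the denominator without
  -- increasing A(θ, ·).  Double negation avoids having to decide whether w is primitive.
  primitive-below : ∀ {d} θ K (w : Vec+1 F d) → ¬ (∀ k → coeff (den w) k ≈ 0#) → SmallV F (err F θ w) K
                  → ¬ ¬ (∃ λ v → InQ F v × _≤Q_ F v w × SmallV F (err F θ v) K)
  primitive-below θ K w den≉0 small no-v = descend (len (den w)) w (vanish (den w)) den≉0 (λ _ p → p) small
    where
    descend : ∀ N w′ → DegreeBelow (den w′) N → ¬ (∀ k → coeff (den w′) k ≈ 0#)
            → _≤Q_ F w′ w → SmallV F (err F θ w′) K → ⊥
    descend zero    w′ below den≉0 _    _     = den≉0 (λ k → below k z≤n)
    descend (suc N) w′ below den≉0 w′≤w small = no-v (w′ , (den≉0 , coprime) , w′≤w , small)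
      where
      coprime : ∀ c → (∀ i → _∣P_ F c (num w′ i)) → _∣P_ F c (den w′) → UnitP F c
      coprime c c∣a c∣b with degree? c | degree? (den w′)
      ... | _                   | inj₁ b≈0          = ⊥-elim (den≉0 b≈0)
      ... | inj₁ c≈0            | _                 = ⊥-elim (den≉0 (divisor-zero c (den w′) c∣b c≈0))
      ... | inj₂ (zero , deg-c) | _                 = constant-unit deg-c
      ... | inj₂ (suc m , deg-c) | inj₂ (n , deg-b) =
        ⊥-elim (descend N q (degree-below-mono e e-below (ℕP.≤-pred (degree-below⇒< deg-b below))) e≉0 q≤w q-small)
        where
        q = quotient c w′ c∣a c∣b
        e = den q
        e-below : DegreeBelow e n
        e-below = small⇒degree-below (cofactor-small (den w′) c∣b deg-c
          (small-mono (degree-below⇒small (Degree.below deg-b)) (ℤ.+≤+ (ℕP.≤-trans (s≤s (ℕP.m≤m+n n m)) (ℕP.≤-reflexive (≡.sym (ℕP.+-suc n m)))))))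
        e≉0 : ¬ (∀ k → coeff e k ≈ 0#)
        e≉0 e≈0 = den≉0 (cofactor-zero c (den w′) c∣b e≈0)
        q≤w : _≤Q_ F q w
        q≤w k b-small = cofactor-small (den w′) c∣b deg-c (small-mono (w′≤w k b-small) (ℤP.i≤i+j k (+ suc m)))
        q-small : SmallV F (err F θ q) K
        q-small i = lead-cancel deg-b (err-bounded θ q i)
          (small-cong (err-quotient θ c w′ c∣a c∣b i)
            (⋆-small e e-below (small i) (ℤP.i≤i+j (K ℤ.+ + n) 1ℤ)))

  -- Best approximations

  den-degree : ∀ {d} (u : Vec+1 F d) → InQ F u → ∃ (Degree (den u))
  den-degree u (den≉0 , _) with degree? (den u)
  ... | inj₁ den≈0 = ⊥-elim (den≉0 den≈0)
  ... | inj₂ deg   = deg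

  ≤Q⇒degree-below : ∀ {d} (v u : Vec+1 F d) {n} → Degree (den u) n → _≤Q_ F v u → DegreeBelow (den v) (suc n)
  ≤Q⇒degree-below v u deg v≤u = small⇒degree-below (v≤u (+ suc _) (degree-below⇒small (Degree.below deg)))

  degree-below⇒≤Q : ∀ {d} (v u : Vec+1 F d) {n} → Degree (den u) n → DegreeBelow (den v) (suc n) → _≤Q_ F v u
  degree-below⇒≤Q v u {n} deg below k u-small with k ℤ.≤? + n
  ... | yes k≤n = ⊥-elim (Degree.lead≉0 deg (u-small (+ n) k≤n))
  ... | no  k≰n = small-mono (degree-below⇒small below) (ℤP.i<j⇒suc[i]≤j (ℤP.≰⇒> k≰n))

  <Q⇒≤Q : ∀ {d} (v u : Vec+1 F d) → _<Q_ F v u → _≤Q_ F v u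
  <Q⇒≤Q v u (k₀ , v-small , u-large) k u-small with ℤP.≤-total k₀ k
  ... | inj₁ k₀≤k = small-mono v-small k₀≤k
  ... | inj₂ k≤k₀ = ⊥-elim (u-large (small-mono u-small k≤k₀))

  <Q⇒¬proportional : ∀ {d} (v u : Vec+1 F d) → _<Q_ F v u → ¬ Proportional F v u
  <Q⇒¬proportional v u (k₀ , v-small , u-large) (c , c≉0 , _ , den≈) =
    u-large (λ j k₀≤j → x≉0∧x*y≈0⇒y≈0 c≉0 (trans (sym (polyZ-scale c den≈ j)) (v-small j k₀≤j)))

  proportional-small : ∀ {d} θ (v u : Vec+1 F d) {k} → Proportional F v u → SmallV F (err F θ v) k → SmallV F (err F θ u) k
  proportional-small θ v u (c , c≉0 , num≈ , den≈) v-small i j k≤j =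
    x≉0∧x*y≈0⇒y≈0 c≉0 (trans (sym (err-scale θ v u c num≈ den≈ i j)) (v-small i j k≤j))

  eliminate-lead : ∀ {q n} p → Degree q n → DegreeBelow p (suc n) → ∃ λ c → DegreeBelow (p -[ c ]· q) n
  eliminate-lead {q} {n} p deg p-below with inverse (coeff q n) (Degree.lead≉0 deg)
  ... | y , qy≈1 = c , below
    where
    c = coeff p n * y
    cq≈p : c * coeff q n ≈ coeff p n
    cq≈p = begin
      (coeff p n * y) * coeff q n   ≈⟨ *-assoc _ _ _ ⟩
      coeff p n * (y * coeff q n)   ≈⟨ *-congˡ (trans (*-comm y _) qy≈1) ⟩
      coeff p n * 1#                ≈⟨ *-identityʳ _ ⟩
      coeff p n                     ∎
    below : DegreeBelow (p -[ c ]· q) n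
    below i n≤i with ℕP.m≤n⇒m<n∨m≡n n≤i
    ... | inj₂ ≡.refl = trans (//-cong₂ refl cq≈p) (-‿inverseʳ _)
    ... | inj₁ n<i    = trans (//-cong₂ (p-below i n<i) (trans (*-congˡ (Degree.below deg i n<i)) (zeroʳ c))) 0-0≈0

  oneP : Poly F
  oneP = record { coeff = oneCoeff F ; len = 1 ; vanish = λ { (suc _) _ → refl } }

  ⌊_⌋ : Series F → Poly F
  ⌊ s ⌋ = record { coeff = λ n → scoeff s (+ n) ; len = suc ℤ.∣ top s ∣ ; vanish = λ n top<n → svanish s (+ n) (top<+n (top s) top<n) }
    where
    top<+n : ∀ t {n} → suc ℤ.∣ t ∣ ℕ.≤ n → t ℤ.< + n
    top<+n (+ _)    ∣t∣<n = ℤ.+<+ ∣t∣<n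
    top<+n -[1+ _ ] _     = ℤ.-<+

  integral-part : ∀ {d} → (Fin d → Series F) → Vec+1 F d
  integral-part θ = record { num = λ i → ⌊ θ i ⌋ ; den = oneP }

  integral-part-InQ : ∀ {d} (θ : Fin d → Series F) → InQ F (integral-part θ)
  integral-part-InQ θ = (λ one≈0 → 1≉0 (one≈0 0)) , λ c _ c∣1 → c∣1

  integral-part-close : ∀ {d} (θ : Fin d → Series F) → SmallV F (err F θ (integral-part θ)) 0ℤ
  integral-part-close θ i (+ m) _ = trans (//-cong₂ oneP⋆θ≈θ refl) (-‿inverseʳ _)
    where
    oneP⋆θ≈θ : (oneP ⋆ scoeff (θ i)) (+ m) ≈ scoeff (θ i) (+ m)
    oneP⋆θ≈θ = trans (+-identityˡ _) (trans (*-identityˡ _) (reflexive (≡.cong (scoeff (θ i)) (ℤP.+-identityʳ (+ m)))))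

  module _ {d} (u : Vec+1 F d) (uQ : InQ F u) (uhat : Fin d → Series F) (hat : IsHat F u uhat) where
    private
      n : ℕ
      n = proj₁ (den-degree u uQ)
      deg : Degree (den u) n
      deg = proj₂ (den-degree u uQ)

    hat-exact : ∀ i j → err F uhat u i j ≈ 0#
    hat-exact i j = trans (//-cong₂ (hat i j) refl) (-‿inverseʳ _)

    proportional-hat : ∀ v c → InQ F v → (∀ k → coeff (den v) k ≈ c * coeff (den u) k)
                     → SmallV F (err F uhat v) 0ℤ → Proportional F v u
    proportional-hat v c (den≉0 , _) den≈ v-close = c , c≉0 , num≈ , den≈
      where
      c≉0 : ¬ c ≈ 0#
      c≉0 c≈0 = den≉0 (λ k → trans (den≈ k) (trans (*-congʳ c≈0) (zeroˡ _)))
      num≈ : ∀ i m → coeff (num v i) m ≈ c * coeff (num u i) m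
      num≈ i m = begin
        coeff (num v i) m                   ≈⟨ x∙y⁻¹≈ε⇒x≈y _ _ (v-close i (+ m) (ℤ.+≤+ z≤n)) ⟨
        (den v ⋆ scoeff (uhat i)) (+ m)     ≈⟨ ⋆-scaleˡ (den v) (den u) c den≈ (scoeff (uhat i)) (+ m) ⟩
        c * (den u ⋆ scoeff (uhat i)) (+ m) ≈⟨ *-congˡ (hat i (+ m)) ⟩
        c * coeff (num u i) m               ∎

    hat-close : ∀ θ v {k} → DegreeBelow (den v) (suc n) → SmallV F (err F θ v) k → SmallV F (err F θ u) k
              → SmallV F (err F uhat v) k
    hat-close θ v {k} v-below v-close u-close i =
      lead-cancel deg (err-bounded uhat v i) (small-cong (λ j → sym (x≈y+z⇒z≈x-y (err-transfer {u = u} {uhat} hat θ v i j)))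
        (small-- (⋆-small (den u) (Degree.below deg) (v-close i) (k+[1+n]≤k+n+1 k n))
                 (⋆-small (den v) v-below (u-close i) (k+[1+n]≤k+n+1 k n))))

    hat-close⁻¹ : ∀ θ w {k} → DegreeBelow (den w) n → SmallV F (err F θ u) (k ℤ.+ 1ℤ) → SmallV F (err F uhat w) k
                → SmallV F (err F θ w) k
    hat-close⁻¹ θ w {k} w-below u-close w-close i =
      lead-cancel deg (err-bounded θ w i) (small-cong (λ j → sym (err-transfer {u = u} {uhat} hat θ w i j))
        (small-+ (⋆-small (den w) w-below (u-close i) (k+1+n≤k+n+1 k n))
                 (⋆-small (den u) (Degree.below deg) (w-close i) (k+[1+n]≤k+n+1 k n))))

    close⇒best : ∀ {ρ} → IsR F u uhat ρ → ∀ θ → SmallV F (err F θ u) ρ → BestApprox F θ u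
    close⇒best {ρ} (_ , r-minimal) θ u-close = shorter , not-longer
      where
      far : ∀ v → InQ F v → _≤Q_ F v u → ¬ Proportional F v u → ¬ SmallV F (err F θ v) ρ
      far v vQ v≤u v∦u v-close = r-minimal v vQ v≤u v∦u (hat-close θ v (≤Q⇒degree-below v u deg v≤u) v-close u-close)
      shorter : ∀ v → InQ F v → _<Q_ F v u → _<N_ F (err F θ u) (err F θ v)
      shorter v vQ v<u = ρ , u-close , far v vQ (<Q⇒≤Q v u v<u) (<Q⇒¬proportional v u v<u)
      not-longer : ∀ v → InQ F v → _≤Q_ F v u → _≤N_ F (err F θ u) (err F θ v)
      not-longer v vQ v≤u k v-small with ℤP.≤-total ρ k
      ... | inj₁ ρ≤k = smallV-mono u-close ρ≤k
      ... | inj₂ k≤ρ = smallV-stable λ u-large →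
        far v vQ v≤u (λ v∥u → u-large (proportional-small θ v u v∥u v-small)) (smallV-mono v-small k≤ρ)

    best⇒close : ∀ {ρ} → IsR F u uhat ρ → ∀ θ → BestApprox F θ u → SmallV F (err F θ u) (ρ ℤ.+ 1ℤ)
    best⇒close {ρ} ((v₀ , v₀Q , v₀≤u , v₀∦u , v₀-close , _) , _) θ (_ , not-longer) =
      ≤-descend (SmallV F (err F θ u)) smallV-mono step (proj₂ (boundedV (err F θ u) (err-bounded θ u)))
      where
      elim = eliminate-lead (den v₀) deg (≤Q⇒degree-below v₀ u deg v₀≤u)
      c = proj₁ elim
      w = v₀ -[ c ]·ᵥ u
      w≤u : _≤Q_ F w u
      w≤u = degree-below⇒≤Q w u deg (degree-below-mono (den w) (proj₂ elim) (ℕP.n≤1+n n))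
      w-hat-close : SmallV F (err F uhat w) (ρ ℤ.+ 1ℤ)
      w-hat-close i j ρ<j = trans (err-sub-scaled uhat v₀ c u i j)
        (trans (//-cong₂ (v₀-close i j ρ<j) (trans (*-congˡ (hat-exact i j)) (zeroʳ c))) 0-0≈0)
      step : ∀ s → ρ ℤ.+ 1ℤ ℤ.≤ s → SmallV F (err F θ u) (s ℤ.+ 1ℤ) → SmallV F (err F θ u) s
      step s ρ<s u-small with 0ℤ ℤ.≤? s | degree? (den w)
      ... | yes 0≤s | _ = smallV-mono (not-longer (integral-part θ) (integral-part-InQ θ)
            (degree-below⇒≤Q (integral-part θ) u deg (λ { (suc _) _ → refl })) 0ℤ (integral-part-close θ)) 0≤s
      ... | no s≱0 | inj₁ w≈0 = ⊥-elim (v₀∦u (proportional-hat v₀ c v₀Q (λ k → x∙y⁻¹≈ε⇒x≈y _ _ (w≈0 k))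
            (smallV-mono v₀-close (ℤP.≤-trans ρ<s (ℤP.<⇒≤ (ℤP.≰⇒> s≱0))))))
      ... | no _ | inj₂ (_ , deg-w) = smallV-stable λ u-large →
            primitive-below θ s w (λ w≈0 → Degree.lead≉0 deg-w (w≈0 _))
              (hat-close⁻¹ θ w (proj₂ elim) u-small (smallV-mono w-hat-close ρ<s))
              λ (v , vQ , v≤w , v-close) → u-large (not-longer v vQ (λ k → v≤w k ∘ w≤u k) s v-close)

lemma4p5 : (F : FiniteField) (d : ℕ) (u : Vec+1 F d) → InQ F u
    → (uhat : Fin d → Series F) → IsHat F u uhat
    → (ρ : ℤ) → IsR F u uhat ρ
    → (∀ θ → SmallV F (err F θ u) ρ → BestApprox F θ u)
      × (∀ θ → BestApprox F θ u → SmallV F (err F θ u) (ρ ℤ.+ ℤ.+ 1))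
lemma4p5 F d u uQ uhat hat ρ r = close⇒best F u uQ uhat hat r , best⇒close F u uQ uhat hat r
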